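{- Let $P=\{p_1,\dots,p_n\}\subset\mathbb{R}^d$ be a finite point set. Let $M:\mathbb{R}^{dn}\to\mathbb{R}^{\binom n2}$, $(v_1,\dots,v_n)\mapsto(\langle v_i-v_j,p_i-p_j\rangle)_{i<j}$, and $\Delta:\mathbb{R}^{\binom n2}\to\mathbb{R}^{\mathcal C(P)}$, $(f_{ij})\mapsto\bigl(\sum_{ij\subseteq C}w^C_{ij}f_{ij}\bigr)_{C\in\mathcal C(P)}$. Then $\operatorname{Im}M\subseteq\ker\Delta$. If moreover $P$ contains $d$ affinely independent points whose spanned hyperplane contains no other point of $P$, then $\operatorname{Im}M=\ker\Delta$.
   Context: $\mathcal C(P)$ is the set of circuits of $P$, i.e. minimal affinely dependent subsets. A self-stress of a straight-line graph with vertex set $C$ and edges $E$ is an assignment of scalars $w_{ij}$ to edges with $\sum_{j:\,ij\in E}w_{ij}(p_i-p_j)=0$ for each vertex $i$. For each circuit $C$, the complete graph on $C$ has, up to a scalar factor, a unique self-stress, all of whose entries are nonzero; $(w^C_{ij})_{i,j\in C}$ denotes a fixed such self-stress. -}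

module Defs where

open import Level using (0ℓ)
open import Data.Nat using (ℕ; zero; suc)
open import Data.Fin using (Fin; zero; suc; _<?_)
open import Data.Fin.Subset using (Subset; _∈_; _∉_; _⊂_)
open import Data.Vec using (lookup)
open import Data.Bool using (Bool; true; false; _∧_; if_then_else_)
open import Data.Product using (Σ; _×_; ∃; _,_)
open import Data.Sum using (_⊎_)
open import Relation.Nullary using (¬_; does)
open import Relation.Binary.PropositionalEquality using (_≡_)
open import Algebra.Core using (Op₁; Op₂)
open import Algebra.Structures using (IsCommutativeRing)

-- An axiomatisation of the real numbers: a Dedekind-complete ordered
-- field (classically this determines ℝ up to isomorphism).

record Reals : Set₁ where
  infix  4 _≈_ _<_
  infixl 6 _+_
  infixl 7 _*_
  field
    Carrier : Set
    _≈_     : Carrier → Carrier → Set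
    _+_ _*_ : Op₂ Carrier
    -_      : Op₁ Carrier
    0# 1#   : Carrier
    isCommutativeRing : IsCommutativeRing _≈_ _+_ _*_ -_ 0# 1#
    0≉1     : ¬ (0# ≈ 1#)
    inverse : ∀ x → ¬ (x ≈ 0#) → ∃ λ y → x * y ≈ 1#
    _<_     : Carrier → Carrier → Set
    <-resp-≈ : ∀ {x x' y y'} → x ≈ x' → y ≈ y' → x < y → x' < y'
    <-irrefl : ∀ {x} → ¬ (x < x)
    <-trans  : ∀ {x y z} → x < y → y < z → x < z
    <-trichotomy : ∀ x y → x < y ⊎ x ≈ y ⊎ y < x
    +-mono-< : ∀ {x y} z → x < y → x + z < y + z
    *-pos    : ∀ {x y} → 0# < x → 0# < y → 0# < x * y
    sup : (S : Carrier → Set) →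
          (∀ {x y} → x ≈ y → S x → S y) →
          (∃ λ x → S x) →
          (∃ λ b → ∀ x → S x → x < b ⊎ x ≈ b) →
          ∃ λ s → (∀ x → S x → x < s ⊎ x ≈ s) ×
                  (∀ b → (∀ x → S x → x < b ⊎ x ≈ b) → s < b ⊎ s ≈ b)

module Geometry (ℝ : Reals) where
  open Reals ℝ public

  _-ᵣ_ : Carrier → Carrier → Carrier
  x -ᵣ y = x + (- y)

  Σ[_] : (m : ℕ) → (Fin m → Carrier) → Carrier
  Σ[ zero ]  f = 0#
  Σ[ suc m ] f = f zero + Σ[ m ] (λ i → f (suc i))

  Vecᵈ : ℕ → Set
  Vecᵈ d = Fin d → Carrier

  Config : ℕ → ℕ → Set
  Config n d = Fin n → Vecᵈ d

  ⟨_,_⟩ : ∀ {d} → Vecᵈ d → Vecᵈ d → Carrier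
  ⟨_,_⟩ {d} x y = Σ[ d ] (λ k → x k * y k)

  [_]? : Bool → Carrier → Carrier
  [ b ]? x = if b then x else 0#

  module _ {n d : ℕ} (p : Config n d) where

    Distinct : Set
    Distinct = ∀ i j → (∀ k → p i k ≈ p j k) → i ≡ j

    SupportedOn : Subset n → (Fin n → Carrier) → Set
    SupportedOn S λ' = ∀ i → i ∉ S → λ' i ≈ 0#

    AffinelyDependent : Subset n → Set
    AffinelyDependent S = Σ (Fin n → Carrier) λ λ' →
      SupportedOn S λ' ×
      (Σ[ n ] λ' ≈ 0#) ×
      (∀ k → Σ[ n ] (λ i → λ' i * p i k) ≈ 0#) ×
      ∃ λ i → ¬ (λ' i ≈ 0#)

    AffinelyIndependent : Subset n → Set
    AffinelyIndependent S = ¬ AffinelyDependent S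

    InAffineSpan : Subset n → Vecᵈ d → Set
    InAffineSpan S x = Σ (Fin n → Carrier) λ λ' →
      SupportedOn S λ' ×
      (Σ[ n ] λ' ≈ 1#) ×
      (∀ k → Σ[ n ] (λ i → λ' i * p i k) ≈ x k)

    IsCircuit : Subset n → Set
    IsCircuit C = AffinelyDependent C ×
                  (∀ C' → C' ⊂ C → AffinelyIndependent C')

    -- w is a self-stress of the complete graph on C
    -- (w i j = w j i is the weight of edge ij; for i ∈ C,
    --  Σ_{j ∈ C} w_ij (p_i - p_j) = 0, the j = i term being 0)
    IsSelfStressOn : Subset n → (Fin n → Fin n → Carrier) → Set
    IsSelfStressOn C w =
      (∀ i j → i ∈ C → j ∈ C → w i j ≈ w j i) ×
      (∀ i → i ∈ C → ∀ k →
         Σ[ n ] (λ j → [ lookup C j ]? (w i j * (p i k -ᵣ p j k))) ≈ 0#)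

    AllEntriesNonzeroOn : Subset n → (Fin n → Fin n → Carrier) → Set
    AllEntriesNonzeroOn C w = ∀ i j → i ∈ C → j ∈ C → ¬ (i ≡ j) → ¬ (w i j ≈ 0#)

    -- M(v)_{ij} = ⟨v_i - v_j , p_i - p_j⟩   (used for i < j)
    M : Config n d → Fin n → Fin n → Carrier
    M v i j = ⟨ (λ k → v i k -ᵣ v j k) , (λ k → p i k -ᵣ p j k) ⟩

    Δ : (Subset n → Fin n → Fin n → Carrier) →
        (Fin n → Fin n → Carrier) → Subset n → Carrier
    Δ w f C = Σ[ n ] (λ i → Σ[ n ] (λ j →
      [ lookup C i ∧ lookup C j ∧ does (i <? j) ]? (w C i j * f i j)))

{-# OPTIONS --safe #-}
module Submission where

-- Im M ⊆ ker Δ: for a self-stress w of the circuit C,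
--   Σ_{i<j} w_ij ⟨v_i − v_j, p_i − p_j⟩ = Σ_i ⟨v_i, Σ_j w_ij (p_i − p_j)⟩ = 0.
--
-- ker Δ ⊆ Im M: let S be the d given points. The vectors p_q − p_j (j ∈ U, j ≠ q) are
-- linearly independent whenever U ∋ q is affinely independent, so v_q can always be chosen
-- to prescribe ⟨v_q − v_j, p_q − p_j⟩ for those j. Adding the points of S one at a time
-- realises f on the edges inside S, and, since no other point lies on the hyperplane
-- spanned by S, each q ∉ S can then be placed so as to realise f on its edges to S.
-- An edge ij with i, j ∉ S lies in a circuit C ⊆ S ∪ {i, j}, as these d + 2 points are
-- affinely dependent; every other edge of C meets S, so Δ(f − M v)_C = 0 reduces to
-- w^C_ij (f − M v)_ij = 0, and w^C_ij ≠ 0.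

open import Level as Level using (Level; _⊔_; 0ℓ)
open import Function using (_∘_; const; id)
open import Function.Bundles using (Equivalence)
open import Data.Bool using (Bool; true; false; if_then_else_; T; _∧_)
open import Data.Bool.Properties using (T-≡; T-∧)
open import Data.Nat as ℕ using (ℕ; zero; suc)
import Data.Nat.Properties as ℕ
open import Data.Integer as ℤ using (ℤ; +_; -[1+_]; _⊖_; _◃_)
import Data.Integer.Properties as ℤ
open import Data.Sign as Sign using (Sign)
open import Data.Maybe using (Maybe; just; nothing)
open import Data.Product as Product using (Σ; ∃; _×_; _,_; proj₁; proj₂)
open import Data.Sum as Sum using (_⊎_; inj₁; inj₂)
open import Data.Fin as Fin using (Fin; zero; suc) renaming (_<_ to _<ᶠ_)
import Data.Fin.Properties as Finₚ
open import Data.Fin.Properties using (punchInᵢ≢i; any?)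
open import Data.Vec.Base as Vec using (lookup; there)
open import Data.Vec.Properties using (lookup⇒[]=; []=⇒lookup)
open import Data.Vec.Functional using (Vector; removeAt; _∷_; tail; updateAt)
open import Data.Vec.Functional.Properties using (updateAt-updates; updateAt-minimal)
open import Data.Fin.Subset using (Subset; _∈_; _∉_; _⊆_; _⊂_; _∪_; ⁅_⁆; ∣_∣; inside; outside) renaming (_-_ to _∖_)
open import Data.Fin.Subset.Properties
  using (_∈?_; x∈⁅y⁆⇒x≡y; x∈⁅x⁆; x∈p∪q⁻; x∈p∪q⁺; p⊆p∪q; p⊂q⇒∣p∣<∣q∣; p─q⊆p; p─⊥≡p;
         x∈p∧x≢y⇒x∈p-y; x∈p⇒p-x⊂p; ⊆-refl; ⊆-trans; nonempty?; Empty-unique; ∣⊥∣≡0)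
open import Data.Fin.Subset.Induction using (⊂-wellFounded)
import Induction.WellFounded as WF
open import Relation.Unary as U using (Pred)
open import Relation.Nullary using (¬_; Dec; does; yes; no; contradiction; ¬?; _×-dec_)
open import Relation.Nullary.Decidable using (decidable-stable; dec-true; dec-false; map′)
open import Relation.Binary.Definitions using (Decidable; tri<; tri≈; tri>)
open import Relation.Binary.PropositionalEquality as ≡ using (_≡_; _≢_)
open import Algebra.Bundles using (CommutativeRing; RawRing)
import Algebra.Solver.Ring.AlmostCommutativeRing as ACR

open import Defs

-- Finite subsets

x∉p∖x : ∀ {n} (p : Subset n) x → x ∉ p ∖ x
x∉p∖x (s Vec.∷ p) zero    ()
x∉p∖x (s Vec.∷ p) (suc x) (there x∈p∖x) = x∉p∖x p x x∈p∖x

∣p∣≤1+∣p∖x∣ : ∀ {n} (p : Subset n) x → ∣ p ∣ ℕ.≤ suc ∣ p ∖ x ∣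
∣p∣≤1+∣p∖x∣ (outside Vec.∷ p) zero    = ℕ.≤-trans (ℕ.≤-reflexive (≡.cong ∣_∣ (≡.sym (p─⊥≡p p)))) (ℕ.n≤1+n _)
∣p∣≤1+∣p∖x∣ (inside  Vec.∷ p) zero    = ℕ.s≤s (ℕ.≤-reflexive (≡.cong ∣_∣ (≡.sym (p─⊥≡p p))))
∣p∣≤1+∣p∖x∣ (outside Vec.∷ p) (suc x) = ∣p∣≤1+∣p∖x∣ p x
∣p∣≤1+∣p∖x∣ (inside  Vec.∷ p) (suc x) = ℕ.s≤s (∣p∣≤1+∣p∖x∣ p x)

T-lookup⇒∈ : ∀ {n} {p : Subset n} {x} → T (lookup p x) → x ∈ p
T-lookup⇒∈ {p = p} {x} t = lookup⇒[]= x p (Equivalence.to T-≡ t)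

∈⇒T-lookup : ∀ {n} {p : Subset n} {x} → x ∈ p → T (lookup p x)
∈⇒T-lookup x∈p = Equivalence.from T-≡ ([]=⇒lookup x∈p)

module _ {n : ℕ} {p : Subset n} {y : Fin n} where

  x∈p∪⁅y⁆⁻ : ∀ {x} → x ∈ p ∪ ⁅ y ⁆ → x ∈ p ⊎ x ≡ y
  x∈p∪⁅y⁆⁻ x∈ = Sum.map₂ (x∈⁅y⁆⇒x≡y y) (x∈p∪q⁻ p ⁅ y ⁆ x∈)

  y∈p∪⁅y⁆ : y ∈ p ∪ ⁅ y ⁆
  y∈p∪⁅y⁆ = x∈p∪q⁺ (inj₂ (x∈⁅x⁆ y))

  q⊆p∪⁅y⁆∧y∉q⇒q⊆p : ∀ {q} → q ⊆ p ∪ ⁅ y ⁆ → y ∉ q → q ⊆ p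
  q⊆p∪⁅y⁆∧y∉q⇒q⊆p q⊆ y∉q x∈q = Sum.[ id , (λ { ≡.refl → contradiction x∈q y∉q }) ] (x∈p∪⁅y⁆⁻ (q⊆ x∈q))

  y∉p⇒p⊂p∪⁅y⁆ : y ∉ p → p ⊂ p ∪ ⁅ y ⁆
  y∉p⇒p⊂p∪⁅y⁆ y∉p = p⊆p∪q ⁅ y ⁆ , y , y∈p∪⁅y⁆ , y∉p

module _ {n : ℕ} {p : Subset n} {y z : Fin n} where

  x∈p∪⁅y⁆∪⁅z⁆⁻ : ∀ {x} → x ∈ (p ∪ ⁅ y ⁆) ∪ ⁅ z ⁆ → x ∈ p ⊎ x ≡ y ⊎ x ≡ z
  x∈p∪⁅y⁆∪⁅z⁆⁻ x∈ = Sum.[ Sum.map₂ inj₁ ∘ x∈p∪⁅y⁆⁻ , inj₂ ∘ inj₂ ] (x∈p∪⁅y⁆⁻ x∈)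

  p∪⁅y⁆∪⁅z⁆⊆p∪⁅z⁆∪⁅y⁆ : (p ∪ ⁅ y ⁆) ∪ ⁅ z ⁆ ⊆ (p ∪ ⁅ z ⁆) ∪ ⁅ y ⁆
  p∪⁅y⁆∪⁅z⁆⊆p∪⁅z⁆∪⁅y⁆ x∈ with x∈p∪⁅y⁆∪⁅z⁆⁻ x∈
  ... | inj₁ x∈p          = x∈p∪q⁺ (inj₁ (x∈p∪q⁺ (inj₁ x∈p)))
  ... | inj₂ (inj₁ ≡.refl) = y∈p∪⁅y⁆
  ... | inj₂ (inj₂ ≡.refl) = x∈p∪q⁺ (inj₁ y∈p∪⁅y⁆)

other-pair-meets : ∀ {n} {p : Subset n} {i j x y} → i Fin.< j →
                   x ∈ (p ∪ ⁅ i ⁆) ∪ ⁅ j ⁆ → y ∈ (p ∪ ⁅ i ⁆) ∪ ⁅ j ⁆ → x Fin.< y → x ≢ i ⊎ y ≢ j →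
                   x ∈ p ⊎ y ∈ p
other-pair-meets i<j x∈ y∈ x<y other with x∈p∪⁅y⁆∪⁅z⁆⁻ x∈ | x∈p∪⁅y⁆∪⁅z⁆⁻ y∈
... | inj₁ x∈p           | _                  = inj₁ x∈p
... | inj₂ _             | inj₁ y∈p           = inj₂ y∈p
... | inj₂ (inj₁ ≡.refl) | inj₂ (inj₁ ≡.refl) = contradiction x<y (Finₚ.<-irrefl ≡.refl)
... | inj₂ (inj₁ ≡.refl) | inj₂ (inj₂ ≡.refl) = contradiction other Sum.[ (λ x≢x → x≢x ≡.refl) , (λ y≢y → y≢y ≡.refl) ]
... | inj₂ (inj₂ ≡.refl) | inj₂ (inj₁ ≡.refl) = contradiction x<y (Finₚ.<-asym i<j)
... | inj₂ (inj₂ ≡.refl) | inj₂ (inj₂ ≡.refl) = contradiction x<y (Finₚ.<-irrefl ≡.refl)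

module _ {a} {A : Set a} {n : ℕ} (f : Fin n → Fin n → A) where

  symmetrise : Fin n → Fin n → A
  symmetrise i j = if does (j Fin.<? i) then f j i else f i j

  symmetrise-< : ∀ {i j} → i Fin.< j → symmetrise i j ≡ f i j
  symmetrise-< {i} {j} i<j rewrite dec-false (j Fin.<? i) (Finₚ.<-asym i<j) = ≡.refl

  symmetrise-comm : ∀ i j → symmetrise i j ≡ symmetrise j i
  symmetrise-comm i j with Finₚ.<-cmp i j
  ... | tri< i<j _ _ rewrite dec-false (j Fin.<? i) (Finₚ.<-asym i<j) | dec-true (i Fin.<? j) i<j = ≡.refl
  ... | tri≈ _ ≡.refl _ = ≡.refl
  ... | tri> _ _ j<i rewrite dec-true (j Fin.<? i) j<i | dec-false (i Fin.<? j) (Finₚ.<-asym j<i) = ≡.refl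

module _ {p} {n : ℕ} {P : Pred (Subset n) p} (P? : U.Decidable P) (P-mono : ∀ {C U} → C ⊆ U → P C → P U) where

  MinimalSubsetWithin : Subset n → Set p
  MinimalSubsetWithin U = ∃ λ C → C ⊆ U × P C × (∀ C′ → C′ ⊂ C → ¬ P C′)

  minimal-⊆ : ∀ U → P U → MinimalSubsetWithin U
  minimal-⊆ = WF.All.wfRec ⊂-wellFounded p (λ U → P U → MinimalSubsetWithin U) step
    where
    step : ∀ U → (∀ {V} → V ⊂ U → P V → MinimalSubsetWithin V) → P U → MinimalSubsetWithin U
    step U rec PU with any? (λ x → x ∈? U ×-dec P? (U ∖ x))
    ... | yes (x , x∈U , P[U∖x]) =
      let C , C⊆U∖x , PC , minimal = rec (x∈p⇒p-x⊂p x∈U) P[U∖x]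
      in  C , ⊆-trans C⊆U∖x (p─q⊆p U ⁅ x ⁆) , PC , minimal
    ... | no  none = U , ⊆-refl , PU , minimal
      where
      minimal : ∀ C′ → C′ ⊂ U → ¬ P C′
      minimal C′ (C′⊆U , x , x∈U , x∉C′) PC′ = none (x , x∈U , P-mono C′⊆U∖x PC′)
        where
        C′⊆U∖x : C′ ⊆ U ∖ x
        C′⊆U∖x y∈C′ = x∈p∧x≢y⇒x∈p-y (C′⊆U y∈C′) λ { ≡.refl → x∉C′ y∈C′ }

-- The ring solver over an arbitrary commutative ring

-- The solver decides equality of coefficients by evaluation, so they are taken from ℤ.
module IntegerCoefficients {c ℓ : Level} (R : CommutativeRing c ℓ) where
  open CommutativeRing R
  open import Algebra.Properties.Ring ring using (-0#≈0#; -‿involutive; -‿+-comm; -‿distribˡ-*; -‿distribʳ-*)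
  open import Algebra.Properties.Semiring.Mult.TCOptimised semiring using (×-homo-+; ×1-homo-*; 1+×) renaming (_×_ to _×ₙ_)
  open import Algebra.Properties.CommutativeSemigroup +-commutativeSemigroup using (interchange)
  open import Relation.Binary.Reasoning.Setoid setoid

  ι : ℤ → Carrier
  ι (+ n)    = n ×ₙ 1#
  ι -[1+ n ] = - (suc n ×ₙ 1#)

  ι-⊖ : ∀ m n → ι (m ⊖ n) ≈ m ×ₙ 1# - n ×ₙ 1#
  ι-⊖ m       zero    = sym (trans (+-congˡ -0#≈0#) (+-identityʳ _))
  ι-⊖ zero    (suc n) = sym (+-identityˡ _)
  ι-⊖ (suc m) (suc n) = begin
    ι (suc m ⊖ suc n)                     ≡⟨ ≡.cong ι (ℤ.[1+m]⊖[1+n]≡m⊖n m n) ⟩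
    ι (m ⊖ n)                             ≈⟨ ι-⊖ m n ⟩
    m ×ₙ 1# - n ×ₙ 1#                     ≈⟨ +-identityˡ _ ⟨
    0# + (m ×ₙ 1# - n ×ₙ 1#)              ≈⟨ +-congʳ (-‿inverseʳ 1#) ⟨
    (1# - 1#) + (m ×ₙ 1# - n ×ₙ 1#)       ≈⟨ interchange 1# (- 1#) (m ×ₙ 1#) (- (n ×ₙ 1#)) ⟩
    (1# + m ×ₙ 1#) + (- 1# - n ×ₙ 1#)     ≈⟨ +-cong (1+× m 1#) (trans (-‿cong (1+× n 1#)) (sym (-‿+-comm 1# (n ×ₙ 1#)))) ⟨
    suc m ×ₙ 1# - suc n ×ₙ 1#             ∎

  ι-+ : ∀ i j → ι (i ℤ.+ j) ≈ ι i + ι j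
  ι-+ (+ m)    (+ n)    = ×-homo-+ 1# m n
  ι-+ (+ m)    -[1+ n ] = ι-⊖ m (suc n)
  ι-+ -[1+ m ] (+ n)    = trans (ι-⊖ n (suc m)) (+-comm _ _)
  ι-+ -[1+ m ] -[1+ n ] = begin
    - (suc (suc (m ℕ.+ n)) ×ₙ 1#)     ≡⟨ ≡.cong (λ k → - (suc k ×ₙ 1#)) (ℕ.+-suc m n) ⟨
    - ((suc m ℕ.+ suc n) ×ₙ 1#)       ≈⟨ -‿cong (×-homo-+ 1# (suc m) (suc n)) ⟩
    - (suc m ×ₙ 1# + suc n ×ₙ 1#)     ≈⟨ -‿+-comm _ _ ⟨
    - (suc m ×ₙ 1#) - suc n ×ₙ 1#     ∎

  ι-neg : ∀ i → ι (ℤ.- i) ≈ - ι i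
  ι-neg (+ zero)  = sym -0#≈0#
  ι-neg (+ suc n) = refl
  ι-neg -[1+ n ]  = sym (-‿involutive _)

  signed : Sign → Carrier → Carrier
  signed Sign.+ x = x
  signed Sign.- x = - x

  ι-◃ : ∀ s n → ι (s ◃ n) ≈ signed s (n ×ₙ 1#)
  ι-◃ Sign.+ zero    = refl
  ι-◃ Sign.- zero    = sym -0#≈0#
  ι-◃ Sign.+ (suc n) = refl
  ι-◃ Sign.- (suc n) = refl

  signed-* : ∀ s t x y → signed (s Sign.* t) (x * y) ≈ signed s x * signed t y
  signed-* Sign.+ Sign.+ x y = refl
  signed-* Sign.+ Sign.- x y = -‿distribʳ-* x y
  signed-* Sign.- Sign.+ x y = -‿distribˡ-* x y
  signed-* Sign.- Sign.- x y = begin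
    x * y             ≈⟨ -‿involutive _ ⟨
    - (- (x * y))     ≈⟨ -‿cong (-‿distribʳ-* x y) ⟩
    - (x * - y)       ≈⟨ -‿distribˡ-* x (- y) ⟩
    - x * - y         ∎

  ι-signed : ∀ i → ι i ≈ signed (ℤ.sign i) (ℤ.∣ i ∣ ×ₙ 1#)
  ι-signed (+ n)    = refl
  ι-signed -[1+ n ] = refl

  ι-* : ∀ i j → ι (i ℤ.* j) ≈ ι i * ι j
  ι-* i j = begin
    ι (s ◃ ∣i∣ ℕ.* ∣j∣)                                              ≈⟨ ι-◃ s (∣i∣ ℕ.* ∣j∣) ⟩
    signed s ((∣i∣ ℕ.* ∣j∣) ×ₙ 1#)                                   ≈⟨ signed-cong s (×1-homo-* ∣i∣ ∣j∣) ⟩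
    signed s (∣i∣ ×ₙ 1# * ∣j∣ ×ₙ 1#)                                 ≈⟨ signed-* (ℤ.sign i) (ℤ.sign j) _ _ ⟩
    signed (ℤ.sign i) (∣i∣ ×ₙ 1#) * signed (ℤ.sign j) (∣j∣ ×ₙ 1#)    ≈⟨ *-cong (ι-signed i) (ι-signed j) ⟨
    ι i * ι j                                                        ∎
    where
    s : Sign
    s = ℤ.sign i Sign.* ℤ.sign j
    ∣i∣ ∣j∣ : ℕ
    ∣i∣ = ℤ.∣ i ∣
    ∣j∣ = ℤ.∣ j ∣
    signed-cong : ∀ s {x y} → x ≈ y → signed s x ≈ signed s y
    signed-cong Sign.+ x≈y = x≈y
    signed-cong Sign.- x≈y = -‿cong x≈y

  ℤ-rawRing : RawRing _ _
  ℤ-rawRing = record { Carrier = ℤ ; _≈_ = _≡_ ; _+_ = ℤ._+_ ; _*_ = ℤ._*_ ; -_ = ℤ.-_ ; 0# = + 0 ; 1# = + 1 }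

  almostCommutativeRing : ACR.AlmostCommutativeRing c ℓ
  almostCommutativeRing = ACR.fromCommutativeRing R

  ι-homomorphism : ℤ-rawRing ACR.-Raw-AlmostCommutative⟶ almostCommutativeRing
  ι-homomorphism = record
    { ⟦_⟧ = ι ; +-homo = ι-+ ; *-homo = ι-* ; -‿homo = ι-neg ; 0-homo = refl ; 1-homo = refl }

  ι-≟ : ∀ i j → Maybe (ι i ≈ ι j)
  ι-≟ i j with i ℤ.≟ j
  ... | yes ≡.refl = just refl
  ... | no _       = nothing

  open import Algebra.Solver.Ring ℤ-rawRing almostCommutativeRing ι-homomorphism ι-≟ public
    using (solve; _:=_; _:+_; _:*_; _:-_; con)

-- Linear algebra over a discrete field

record DiscreteField c ℓ : Set (Level.suc (c ⊔ ℓ)) where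
  field
    commutativeRing : CommutativeRing c ℓ
  open CommutativeRing commutativeRing using (Carrier; _≈_; _*_; 0#; 1#)
  field
    _≟_     : Decidable _≈_
    1≉0     : ¬ 1# ≈ 0#
    inverse : ∀ x → ¬ x ≈ 0# → ∃ λ y → x * y ≈ 1#

module LinearAlgebra {c ℓ : Level} (F : DiscreteField c ℓ) where

  open DiscreteField F
  open CommutativeRing commutativeRing hiding (zero)
  open import Algebra.Properties.Ring ring using (-1*x≈-x; -0#≈0#)
  open import Algebra.Properties.Semiring.Sum semiring public
    using (sum; sum-cong-≋; sum-cong-≗; ∑-distrib-+; ∑-comm; *-distribˡ-sum; *-distribʳ-sum; sum-replicate-zero; sum-remove)
  open IntegerCoefficients commutativeRing using (solve; _:=_; _:+_; _:*_; _:-_; con)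
  open import Relation.Binary.Reasoning.Setoid setoid

  sum-zero : ∀ {m} {f : Vector Carrier m} → (∀ i → f i ≈ 0#) → sum f ≈ 0#
  sum-zero {m} f≈0 = trans (sum-cong-≋ f≈0) (sum-replicate-zero m)

  sum-neg : ∀ {m} (f : Vector Carrier m) → sum (λ i → - f i) ≈ - sum f
  sum-neg f = begin
    sum (λ i → - f i)        ≈⟨ sum-cong-≋ (λ i → -1*x≈-x (f i)) ⟨
    sum (λ i → - 1# * f i)   ≈⟨ *-distribˡ-sum (- 1#) f ⟨
    - 1# * sum f             ≈⟨ -1*x≈-x (sum f) ⟩
    - sum f                  ∎

  sum-minus : ∀ {m} (f g : Vector Carrier m) → sum (λ i → f i - g i) ≈ sum f - sum g
  sum-minus f g = trans (∑-distrib-+ f (λ i → - g i)) (+-congˡ (sum-neg g))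

  sum-single : ∀ {m} (f : Vector Carrier m) i → (∀ j → j ≢ i → f j ≈ 0#) → sum f ≈ f i
  sum-single {suc m} f i others≈0 = begin
    sum f                          ≈⟨ sum-remove f ⟩
    f i + sum (removeAt f i)       ≈⟨ +-congˡ (sum-zero (λ j → others≈0 _ (punchInᵢ≢i i j))) ⟩
    f i + 0#                       ≈⟨ +-identityʳ (f i) ⟩
    f i                            ∎

  if-distrib-+ : ∀ b x y → (if b then x + y else 0#) ≈ (if b then x else 0#) + (if b then y else 0#)
  if-distrib-+ true  x y = refl
  if-distrib-+ false x y = sym (+-identityˡ 0#)

  sum-over-pairs : ∀ {m} (G : Fin m → Fin m → Carrier) → (∀ i → G i i ≈ 0#) →
                   sum (λ i → sum (λ j → if does (i Fin.<? j) then G i j + G j i else 0#)) ≈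
                   sum (λ i → sum (λ j → G i j))
  sum-over-pairs G G-diag≈0 = begin
    sum (λ i → sum (λ j → [ i < j ] (G i j + G j i)))                       ≈⟨ sum-cong-≋ (λ i → sum-cong-≋ (λ j → if-distrib-+ (does (i Fin.<? j)) (G i j) (G j i))) ⟩
    sum (λ i → sum (λ j → [ i < j ] G i j + [ i < j ] G j i))               ≈⟨ sum-cong-≋ (λ i → ∑-distrib-+ (λ j → [ i < j ] G i j) (λ j → [ i < j ] G j i)) ⟩
    sum (λ i → sum (λ j → [ i < j ] G i j) + sum (λ j → [ i < j ] G j i))   ≈⟨ ∑-distrib-+ (λ i → sum (λ j → [ i < j ] G i j)) (λ i → sum (λ j → [ i < j ] G j i)) ⟩
    sum (λ i → sum (λ j → [ i < j ] G i j)) + sum (λ i → sum (λ j → [ i < j ] G j i)) ≈⟨ +-congˡ (∑-comm (λ i j → [ i < j ] G j i)) ⟩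
    sum (λ i → sum (λ j → [ i < j ] G i j)) + sum (λ i → sum (λ j → [ j < i ] G i j)) ≈⟨ ∑-distrib-+ (λ i → sum (λ j → [ i < j ] G i j)) (λ i → sum (λ j → [ j < i ] G i j)) ⟨
    sum (λ i → sum (λ j → [ i < j ] G i j) + sum (λ j → [ j < i ] G i j))   ≈⟨ sum-cong-≋ (λ i → ∑-distrib-+ (λ j → [ i < j ] G i j) (λ j → [ j < i ] G i j)) ⟨
    sum (λ i → sum (λ j → [ i < j ] G i j + [ j < i ] G i j))               ≈⟨ sum-cong-≋ (λ i → sum-cong-≋ (λ j → one-orientation i j)) ⟩
    sum (λ i → sum (λ j → G i j))                                           ∎
    where
    [_<_]_ : ∀ {m} → Fin m → Fin m → Carrier → Carrier
    [ i < j ] x = if does (i Fin.<? j) then x else 0#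
    one-orientation : ∀ i j → [ i < j ] G i j + [ j < i ] G i j ≈ G i j
    one-orientation i j with Finₚ.<-cmp i j
    ... | tri< i<j _ _ rewrite dec-true (i Fin.<? j) i<j | dec-false (j Fin.<? i) (Finₚ.<-asym i<j) = +-identityʳ _
    ... | tri> _ _ j<i rewrite dec-false (i Fin.<? j) (Finₚ.<-asym j<i) | dec-true (j Fin.<? i) j<i = +-identityˡ _
    ... | tri≈ _ ≡.refl _ rewrite dec-false (i Fin.<? i) (Finₚ.<-irrefl ≡.refl) = trans (+-identityˡ 0#) (sym (G-diag≈0 i))

  δ : ∀ {m} → Fin m → Fin m → Carrier
  δ i j with i Fin.≟ j
  ... | yes _ = 1#
  ... | no  _ = 0#

  δ-diag : ∀ {m} (i : Fin m) → δ i i ≈ 1#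
  δ-diag i with i Fin.≟ i
  ... | yes _   = refl
  ... | no  i≢i = contradiction ≡.refl i≢i

  δ-offdiag : ∀ {m} {i j : Fin m} → i ≢ j → δ i j ≈ 0#
  δ-offdiag {i = i} {j} i≢j with i Fin.≟ j
  ... | yes i≡j = contradiction i≡j i≢j
  ... | no  _   = refl

  sum-δ : ∀ {m} i (f : Vector Carrier m) → sum (λ j → δ i j * f j) ≈ f i
  sum-δ i f = begin
    sum (λ j → δ i j * f j)  ≈⟨ sum-single _ i (λ j j≢i → trans (*-congʳ (δ-offdiag (j≢i ∘ ≡.sym))) (zeroˡ (f j))) ⟩
    δ i i * f i              ≈⟨ *-congʳ (δ-diag i) ⟩
    1# * f i                 ≈⟨ *-identityˡ (f i) ⟩
    f i                      ∎

  t≈1⇒x-t*x≈0 : ∀ {t} x → t ≈ 1# → x - t * x ≈ 0#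
  t≈1⇒x-t*x≈0 x t≈1 = trans (+-congˡ (-‿cong (trans (*-congʳ t≈1) (*-identityˡ x)))) (-‿inverseʳ x)

  x-y≈z⇒x≈z+y : ∀ {x y z} → x - y ≈ z → x ≈ z + y
  x-y≈z⇒x≈z+y {x} {y} {z} x-y≈z = trans (solve 2 (λ x y → x := (x :- y) :+ y) refl x y) (+-congʳ x-y≈z)

  x≉0∧x*y≈0⇒y≈0 : ∀ {x y} → ¬ x ≈ 0# → x * y ≈ 0# → y ≈ 0#
  x≉0∧x*y≈0⇒y≈0 {x} {y} x≉0 xy≈0 = begin
    y              ≈⟨ *-identityˡ y ⟨
    1# * y         ≈⟨ *-congʳ (trans (*-comm x⁻¹ x) (proj₂ (inverse x x≉0))) ⟨
    x⁻¹ * x * y    ≈⟨ *-assoc x⁻¹ x y ⟩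
    x⁻¹ * (x * y)  ≈⟨ *-congˡ xy≈0 ⟩
    x⁻¹ * 0#       ≈⟨ zeroʳ x⁻¹ ⟩
    0#             ∎
    where
    x⁻¹ : Carrier
    x⁻¹ = proj₁ (inverse x x≉0)

  infix 7 _∙_
  _∙_ : ∀ {D} → Vector Carrier D → Vector Carrier D → Carrier
  x ∙ y = sum (λ k → x k * y k)

  ∙-comm : ∀ {D} (x y : Vector Carrier D) → x ∙ y ≈ y ∙ x
  ∙-comm x y = sum-cong-≋ (λ k → *-comm (x k) (y k))

  ∙-distrib-minusˡ : ∀ {D} (x y z : Vector Carrier D) → (λ k → x k - y k) ∙ z ≈ x ∙ z - y ∙ z
  ∙-distrib-minusˡ x y z = begin
    sum (λ k → (x k - y k) * z k)        ≈⟨ sum-cong-≋ (λ k → solve 3 (λ x y z → (x :- y) :* z := x :* z :- y :* z) refl (x k) (y k) (z k)) ⟩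
    sum (λ k → x k * z k - y k * z k)    ≈⟨ sum-minus (λ k → x k * z k) (λ k → y k * z k) ⟩
    x ∙ z - y ∙ z                        ∎

  combination-∙ : ∀ {m D} (λ′ : Vector Carrier m) (a : Fin m → Vector Carrier D) x →
                  sum (λ i → λ′ i * (a i ∙ x)) ≈ sum (λ k → sum (λ i → λ′ i * a i k) * x k)
  combination-∙ λ′ a x = begin
    sum (λ i → λ′ i * (a i ∙ x))                ≈⟨ sum-cong-≋ (λ i → *-distribˡ-sum (λ′ i) (λ k → a i k * x k)) ⟩
    sum (λ i → sum (λ k → λ′ i * (a i k * x k))) ≈⟨ ∑-comm (λ i k → λ′ i * (a i k * x k)) ⟩
    sum (λ k → sum (λ i → λ′ i * (a i k * x k))) ≈⟨ sum-cong-≋ (λ k → sum-cong-≋ (λ i → *-assoc (λ′ i) (a i k) (x k))) ⟨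
    sum (λ k → sum (λ i → λ′ i * a i k * x k))   ≈⟨ sum-cong-≋ (λ k → *-distribʳ-sum (x k) (λ i → λ′ i * a i k)) ⟨
    sum (λ k → sum (λ i → λ′ i * a i k) * x k)   ∎

  module _ {m D : ℕ} (S : Subset m) (a : Fin m → Vector Carrier D) where

    LinearlyDependent : Set (c ⊔ ℓ)
    LinearlyDependent = Σ (Vector Carrier m) λ λ′ →
      (∀ i → i ∉ S → λ′ i ≈ 0#) ×
      (∀ k → sum (λ i → λ′ i * a i k) ≈ 0#) ×
      ∃ λ i → ¬ λ′ i ≈ 0#

    Solvable : Set (c ⊔ ℓ)
    Solvable = ∀ (b : Vector Carrier m) → ∃ λ x → ∀ i → i ∈ S → a i ∙ x ≈ b i

  module _ {m D : ℕ} {S : Subset m} {a : Fin m → Vector Carrier (suc D)} where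

    dependent-tail : (∀ i → i ∈ S → a i zero ≈ 0#) → LinearlyDependent S (tail ∘ a) → LinearlyDependent S a
    dependent-tail first≈0 (λ′ , supp , comb , nonzero) = λ′ , supp , comb′ , nonzero
      where
      first-term≈0 : ∀ i → λ′ i * a i zero ≈ 0#
      first-term≈0 i with i ∈? S
      ... | yes i∈S = trans (*-congˡ (first≈0 i i∈S)) (zeroʳ _)
      ... | no  i∉S = trans (*-congʳ (supp i i∉S)) (zeroˡ _)
      comb′ : ∀ k → sum (λ i → λ′ i * a i k) ≈ 0#
      comb′ zero    = sum-zero first-term≈0
      comb′ (suc k) = comb k

    solvable-tail : Solvable S (tail ∘ a) → Solvable S a
    solvable-tail solve b = (0# ∷ x) , λ i i∈S → begin
      a i ∙ (0# ∷ x)             ≡⟨⟩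
      a i zero * 0# + tail (a i) ∙ x ≈⟨ +-congʳ (zeroʳ _) ⟩
      0# + tail (a i) ∙ x        ≈⟨ +-identityˡ _ ⟩
      tail (a i) ∙ x             ≈⟨ x-ok i i∈S ⟩
      b i                        ∎
      where
      x : Vector Carrier D
      x = proj₁ (solve b)
      x-ok : ∀ i → i ∈ S → tail (a i) ∙ x ≈ b i
      x-ok = proj₂ (solve b)

  module Pivot {m D : ℕ} (a : Fin m → Vector Carrier (suc D)) (i₀ : Fin m) {α : Carrier}
               (α-inv : a i₀ zero * α ≈ 1#) where

    t : Fin m → Carrier
    t i = a i zero * α

    reduced : Fin m → Vector Carrier (suc D)
    reduced i k = a i k - t i * a i₀ k

    reduced-first≈0 : ∀ i → reduced i zero ≈ 0#
    reduced-first≈0 i = begin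
      a i zero - a i zero * α * a i₀ zero    ≈⟨ +-congˡ (-‿cong (solve 3 (λ x α y → x :* α :* y := y :* α :* x) refl (a i zero) α (a i₀ zero))) ⟩
      a i zero - a i₀ zero * α * a i zero    ≈⟨ t≈1⇒x-t*x≈0 (a i zero) α-inv ⟩
      0#                                     ∎

    module _ {S : Subset m} where

      dependent : i₀ ∈ S → LinearlyDependent (S ∖ i₀) (tail ∘ reduced) → LinearlyDependent S a
      dependent i₀∈S (λ′ , supp , comb , i , λ′i≉0) = μ , supp′ , comb′ , i , μi≉0
        where
        s : Carrier
        s = sum (λ j → λ′ j * t j)
        μ : Vector Carrier m
        μ j = λ′ j - s * δ i₀ j
        μ-off-pivot : ∀ {j} → j ≢ i₀ → μ j ≈ λ′ j
        μ-off-pivot j≢i₀ = trans (+-congˡ (trans (-‿cong (trans (*-congˡ (δ-offdiag (j≢i₀ ∘ ≡.sym))) (zeroʳ s))) -0#≈0#)) (+-identityʳ _)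
        supp′ : ∀ j → j ∉ S → μ j ≈ 0#
        supp′ j j∉S = trans (μ-off-pivot (λ { ≡.refl → j∉S i₀∈S })) (supp j (j∉S ∘ p─q⊆p S _))
        combination : ∀ k → sum (λ j → μ j * a j k) ≈ sum (λ j → λ′ j * reduced j k)
        combination k = begin
          sum (λ j → μ j * a j k)                           ≈⟨ sum-cong-≋ (λ j → solve 4 (λ l s d x → (l :- s :* d) :* x := l :* x :- s :* (d :* x)) refl (λ′ j) s (δ i₀ j) (a j k)) ⟩
          sum (λ j → λ′ j * a j k - s * (δ i₀ j * a j k))   ≈⟨ sum-minus (λ j → λ′ j * a j k) (λ j → s * (δ i₀ j * a j k)) ⟩
          sum (λ j → λ′ j * a j k) - sum (λ j → s * (δ i₀ j * a j k))  ≈⟨ +-congˡ (-‿cong (*-distribˡ-sum s (λ j → δ i₀ j * a j k))) ⟨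
          sum (λ j → λ′ j * a j k) - s * sum (λ j → δ i₀ j * a j k)    ≈⟨ +-congˡ (-‿cong (*-congˡ (sum-δ i₀ (λ j → a j k)))) ⟩
          sum (λ j → λ′ j * a j k) - s * a i₀ k                        ≈⟨ +-congˡ (-‿cong (*-distribʳ-sum (a i₀ k) (λ j → λ′ j * t j))) ⟩
          sum (λ j → λ′ j * a j k) - sum (λ j → λ′ j * t j * a i₀ k)   ≈⟨ sum-minus (λ j → λ′ j * a j k) (λ j → λ′ j * t j * a i₀ k) ⟨
          sum (λ j → λ′ j * a j k - λ′ j * t j * a i₀ k)               ≈⟨ sum-cong-≋ (λ j → solve 4 (λ l x t y → l :* x :- l :* t :* y := l :* (x :- t :* y)) refl (λ′ j) (a j k) (t j) (a i₀ k)) ⟩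
          sum (λ j → λ′ j * reduced j k)                    ∎
        comb′ : ∀ k → sum (λ j → μ j * a j k) ≈ 0#
        comb′ zero    = trans (combination zero) (sum-zero (λ j → trans (*-congˡ (reduced-first≈0 j)) (zeroʳ _)))
        comb′ (suc k) = trans (combination (suc k)) (comb k)
        i≢i₀ : i ≢ i₀
        i≢i₀ ≡.refl = λ′i≉0 (supp i₀ (x∉p∖x S i₀))
        μi≉0 : ¬ μ i ≈ 0#
        μi≉0 μi≈0 = λ′i≉0 (trans (sym (μ-off-pivot i≢i₀)) μi≈0)

      solvable : Solvable (S ∖ i₀) (tail ∘ reduced) → Solvable S a
      solvable solve-reduced b = x , x-ok
        where
        y : Vector Carrier D
        y = proj₁ (solve-reduced (λ i → b i - t i * b i₀))
        y-ok : ∀ i → i ∈ S ∖ i₀ → tail (reduced i) ∙ y ≈ b i - t i * b i₀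
        y-ok = proj₂ (solve-reduced (λ i → b i - t i * b i₀))
        π : Carrier
        π = tail (a i₀) ∙ y
        x : Vector Carrier (suc D)
        x = (b i₀ - π) * α ∷ y
        reduced-∙ : ∀ i → tail (reduced i) ∙ y ≈ tail (a i) ∙ y - t i * π
        reduced-∙ i = begin
          sum (λ k → (a i (suc k) - t i * a i₀ (suc k)) * y k)            ≈⟨ sum-cong-≋ (λ k → solve 4 (λ x t z y → (x :- t :* z) :* y := x :* y :- t :* (z :* y)) refl (a i (suc k)) (t i) (a i₀ (suc k)) (y k)) ⟩
          sum (λ k → a i (suc k) * y k - t i * (a i₀ (suc k) * y k))      ≈⟨ sum-minus (λ k → a i (suc k) * y k) (λ k → t i * (a i₀ (suc k) * y k)) ⟩
          tail (a i) ∙ y - sum (λ k → t i * (a i₀ (suc k) * y k))         ≈⟨ +-congˡ (-‿cong (*-distribˡ-sum (t i) (λ k → a i₀ (suc k) * y k))) ⟨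
          tail (a i) ∙ y - t i * π                                        ∎
        row : ∀ i → tail (reduced i) ∙ y ≈ b i - t i * b i₀ → a i ∙ x ≈ b i
        row i reduced-ok = begin
          a i zero * ((b i₀ - π) * α) + tail (a i) ∙ y                    ≈⟨ +-congˡ (x-y≈z⇒x≈z+y (trans (sym (reduced-∙ i)) reduced-ok)) ⟩
          a i zero * ((b i₀ - π) * α) + ((b i - t i * b i₀) + t i * π)   ≈⟨ solve 5 (λ x α b₀ t b → x :* ((b₀ :- t) :* α) :+ ((b :- x :* α :* b₀) :+ x :* α :* t) := b) refl (a i zero) α (b i₀) π (b i) ⟩
          b i                                                             ∎
        x-ok : ∀ i → i ∈ S → a i ∙ x ≈ b i
        x-ok i i∈S with i Fin.≟ i₀
        ... | yes ≡.refl = row i₀ (trans (sum-zero (λ k → trans (*-congʳ (t≈1⇒x-t*x≈0 (a i₀ (suc k)) α-inv)) (zeroˡ (y k)))) (sym (t≈1⇒x-t*x≈0 (b i₀) α-inv)))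
        ... | no  i≢i₀   = row i (y-ok i (x∈p∧x≢y⇒x∈p-y i∈S i≢i₀))

  -- Gaussian elimination, one coordinate at a time.
  dependent-or-solvable : ∀ {m} D (S : Subset m) (a : Fin m → Vector Carrier D) →
                          LinearlyDependent S a ⊎ (Solvable S a × ∣ S ∣ ℕ.≤ D)
  dependent-or-solvable {m} zero S a with nonempty? S
  ... | yes (i , i∈S) = inj₁ (δ i , (λ j j∉S → δ-offdiag {i = i} {j} λ { ≡.refl → j∉S i∈S }) , (λ ()) , i , 1≉0 ∘ trans (sym (δ-diag i)))
  ... | no  S-empty   = inj₂ (solvable-∅ , ℕ.≤-reflexive (≡.trans (≡.cong ∣_∣ (Empty-unique S-empty)) (∣⊥∣≡0 m)))
    where
    solvable-∅ : Solvable S a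
    solvable-∅ b = (λ ()) , λ i i∈S → contradiction (i , i∈S) S-empty
  dependent-or-solvable (suc D) S a with any? (λ i → i ∈? S ×-dec ¬? (a i zero ≟ 0#))
  ... | yes (i₀ , i₀∈S , pivot≉0) =
    Sum.map (dependent i₀∈S) (Product.map solvable (λ ∣S∖i₀∣≤D → ℕ.≤-trans (∣p∣≤1+∣p∖x∣ S i₀) (ℕ.s≤s ∣S∖i₀∣≤D)))
            (dependent-or-solvable D (S ∖ i₀) (tail ∘ reduced))
    where open Pivot a i₀ (proj₂ (inverse _ pivot≉0))
  ... | no  no-pivot =
    Sum.map (dependent-tail {a = a} first≈0) (Product.map (solvable-tail {a = a}) ℕ.m≤n⇒m≤1+n)
            (dependent-or-solvable D S (tail ∘ a))
    where
    first≈0 : ∀ i → i ∈ S → a i zero ≈ 0#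
    first≈0 i i∈S = decidable-stable (a i zero ≟ 0#) (λ ≉0 → no-pivot (i , i∈S , ≉0))

  dependence⇒combination : ∀ {m D} (a : Fin m → Vector Carrier D) (λ′ : Vector Carrier m) q →
    (∀ k → sum (λ j → λ′ j * a j k) ≈ 0#) → ¬ λ′ q ≈ 0# →
    ∃ λ μ → μ q ≈ 0# × (∀ j → λ′ j ≈ 0# → μ j ≈ 0#) × ∀ k → sum (λ j → μ j * a j k) ≈ a q k
  dependence⇒combination a λ′ q dependence λ′q≉0 = μ , μq≈0 , μ-supported , combination
    where
    γ : Carrier
    γ = proj₁ (inverse (λ′ q) λ′q≉0)
    λ′qγ≈1 : λ′ q * γ ≈ 1#
    λ′qγ≈1 = proj₂ (inverse (λ′ q) λ′q≉0)
    μ : Vector Carrier _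
    μ j = λ′ j * γ * δ q j - λ′ j * γ
    μq≈0 : μ q ≈ 0#
    μq≈0 = trans (+-congʳ (trans (*-congˡ (δ-diag q)) (*-identityʳ _))) (-‿inverseʳ _)
    μ-supported : ∀ j → λ′ j ≈ 0# → μ j ≈ 0#
    μ-supported j λ′j≈0 = begin
      λ′ j * γ * δ q j - λ′ j * γ    ≈⟨ +-cong (*-congʳ (*-congʳ λ′j≈0)) (-‿cong (*-congʳ λ′j≈0)) ⟩
      0# * γ * δ q j - 0# * γ        ≈⟨ solve 2 (λ γ d → con (+ 0) :* γ :* d :- con (+ 0) :* γ := con (+ 0)) refl γ (δ q j) ⟩
      0#                             ∎
    combination : ∀ k → sum (λ j → μ j * a j k) ≈ a q k
    combination k = begin
      sum (λ j → μ j * a j k)                                          ≈⟨ sum-cong-≋ (λ j → solve 4 (λ l γ d x → (l :* γ :* d :- l :* γ) :* x := d :* (l :* γ :* x) :- γ :* (l :* x)) refl (λ′ j) γ (δ q j) (a j k)) ⟩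
      sum (λ j → δ q j * (λ′ j * γ * a j k) - γ * (λ′ j * a j k))      ≈⟨ sum-minus (λ j → δ q j * (λ′ j * γ * a j k)) (λ j → γ * (λ′ j * a j k)) ⟩
      sum (λ j → δ q j * (λ′ j * γ * a j k)) - sum (λ j → γ * (λ′ j * a j k)) ≈⟨ +-cong (sym (sum-δ q (λ j → λ′ j * γ * a j k))) (-‿cong (*-distribˡ-sum γ (λ j → λ′ j * a j k))) ⟨
      λ′ q * γ * a q k - γ * sum (λ j → λ′ j * a j k)                  ≈⟨ +-cong (*-congʳ λ′qγ≈1) (-‿cong (*-congˡ (dependence k))) ⟩
      1# * a q k - γ * 0#                                              ≈⟨ solve 2 (λ x γ → con (+ 1) :* x :- γ :* con (+ 0) := x) refl (a q k) γ ⟩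
      a q k                                                            ∎

  module _ {m D : ℕ} {S : Subset m} {a : Fin m → Vector Carrier D} where

    solvable⇒independent : Solvable S a → ¬ LinearlyDependent S a
    solvable⇒independent solve-a (λ′ , supp , comb , i , λ′i≉0) = λ′i≉0 (begin
      λ′ i                                        ≈⟨ sum-δ i λ′ ⟨
      sum (λ j → δ i j * λ′ j)                    ≈⟨ sum-cong-≋ term ⟩
      sum (λ j → λ′ j * (a j ∙ x))                ≈⟨ combination-∙ λ′ a x ⟩
      sum (λ k → sum (λ j → λ′ j * a j k) * x k)  ≈⟨ sum-zero (λ k → trans (*-congʳ (comb k)) (zeroˡ (x k))) ⟩
      0#                                          ∎)
      where
      x : Vector Carrier D
      x = proj₁ (solve-a (δ i))
      x-ok : ∀ j → j ∈ S → a j ∙ x ≈ δ i j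
      x-ok = proj₂ (solve-a (δ i))
      term : ∀ j → δ i j * λ′ j ≈ λ′ j * (a j ∙ x)
      term j with j ∈? S
      ... | yes j∈S = trans (*-comm _ _) (*-congˡ (sym (x-ok j j∈S)))
      ... | no  j∉S = trans (*-congˡ (supp j j∉S)) (trans (zeroʳ _) (sym (trans (*-congʳ (supp j j∉S)) (zeroˡ _))))

    independent⇒solvable : ¬ LinearlyDependent S a → Solvable S a
    independent⇒solvable independent with dependent-or-solvable D S a
    ... | inj₁ dependent    = contradiction dependent independent
    ... | inj₂ (solvable , _) = solvable

    dependent-if-too-many : D ℕ.< ∣ S ∣ → LinearlyDependent S a
    dependent-if-too-many D<∣S∣ with dependent-or-solvable D S a
    ... | inj₁ dependent    = dependent
    ... | inj₂ (_ , ∣S∣≤D)  = contradiction ∣S∣≤D (ℕ.<⇒≱ D<∣S∣)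

    linearlyDependent? : Dec (LinearlyDependent S a)
    linearlyDependent? with dependent-or-solvable D S a
    ... | inj₁ dependent      = yes dependent
    ... | inj₂ (solvable , _) = no (solvable⇒independent solvable)

-- Point configurations

module Configurations (ℝ : Reals) where
  open Geometry ℝ

  commutativeRing : CommutativeRing 0ℓ 0ℓ
  commutativeRing = record { isCommutativeRing = isCommutativeRing }

  open CommutativeRing commutativeRing
    using (_-_; refl; sym; trans; reflexive; setoid; distribˡ; +-cong; +-congˡ; +-congʳ; *-congˡ; *-congʳ; -‿cong;
           +-identityˡ; +-identityʳ; *-identityʳ; zeroʳ; -‿inverseʳ)

  open import Algebra.Properties.Ring (CommutativeRing.ring commutativeRing) using (-0#≈0#; x≈y⇒x∙y⁻¹≈ε; x∙y⁻¹≈ε⇒x≈y)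

  _≟_ : Decidable _≈_
  x ≟ y with <-trichotomy x y
  ... | inj₁ x<y        = no λ x≈y → <-irrefl (<-resp-≈ refl (sym x≈y) x<y)
  ... | inj₂ (inj₁ x≈y) = yes x≈y
  ... | inj₂ (inj₂ y<x) = no λ x≈y → <-irrefl (<-resp-≈ (sym x≈y) refl y<x)

  discreteField : DiscreteField 0ℓ 0ℓ
  discreteField = record { commutativeRing = commutativeRing ; _≟_ = _≟_ ; 1≉0 = 0≉1 ∘ sym ; inverse = inverse }

  open LinearAlgebra discreteField
  open IntegerCoefficients commutativeRing using (solve; _:=_; _:+_; _:*_; _:-_; con)
  open import Relation.Binary.Reasoning.Setoid setoid

  Σ≡sum : ∀ {m} (f : Fin m → Carrier) → Σ[ m ] f ≡ sum f
  Σ≡sum {zero}  f = ≡.refl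
  Σ≡sum {suc m} f = ≡.cong (λ s → f zero + s) (Σ≡sum (f ∘ suc))

  []?-cong : ∀ b {x y} → x ≈ y → [ b ]? x ≈ [ b ]? y
  []?-cong true  x≈y = x≈y
  []?-cong false x≈y = refl

  []?-≈0 : ∀ b {x} → (T b → x ≈ 0#) → [ b ]? x ≈ 0#
  []?-≈0 true  x≈0 = x≈0 _
  []?-≈0 false x≈0 = refl

  []?-minus : ∀ b x y → [ b ]? (x - y) ≈ [ b ]? x - [ b ]? y
  []?-minus true  x y = refl
  []?-minus false x y = sym (trans (+-congˡ -0#≈0#) (+-identityʳ 0#))

  []?-pair : ∀ a b l {x y z} → (T a → T b → x ≈ y + z) → [ a ∧ b ∧ l ]? x ≈ [ l ]? ([ a ∧ b ]? y + [ b ∧ a ]? z)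
  []?-pair true  true  true  x≈y+z = x≈y+z _ _
  []?-pair true  true  false x≈y+z = refl
  []?-pair true  false l     x≈y+z = sym ([]?-≈0 l (λ _ → +-identityˡ 0#))
  []?-pair false true  l     x≈y+z = sym ([]?-≈0 l (λ _ → +-identityˡ 0#))
  []?-pair false false l     x≈y+z = sym ([]?-≈0 l (λ _ → +-identityˡ 0#))

  []?-true : ∀ b {x} → T b → [ b ]? x ≈ x
  []?-true true _ = refl

  module _ {n d : ℕ} (p : Config n d) where

    M≡∙ : ∀ v i j → M p v i j ≡ (λ k → v i k - v j k) ∙ (λ k → p i k - p j k)
    M≡∙ v i j = Σ≡sum (λ k → (v i k - v j k) * (p i k - p j k))

    M-sym : ∀ v i j → M p v i j ≈ M p v j i
    M-sym v i j = begin
      M p v i j                                          ≡⟨ M≡∙ v i j ⟩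
      (λ k → v i k - v j k) ∙ (λ k → p i k - p j k)      ≈⟨ sum-cong-≋ (λ k → solve 4 (λ a b c e → (a :- b) :* (c :- e) := (b :- a) :* (e :- c)) refl (v i k) (v j k) (p i k) (p j k)) ⟩
      (λ k → v j k - v i k) ∙ (λ k → p j k - p i k)      ≡⟨ M≡∙ v j i ⟨
      M p v j i                                          ∎

    homogenize : Fin n → Vector Carrier (suc d)
    homogenize i = 1# ∷ p i

    affine⇒linear : ∀ {U} → AffinelyDependent p U → LinearlyDependent U homogenize
    affine⇒linear (λ′ , supp , Σλ′≈0 , Σλ′p≈0 , nonzero) = λ′ , supp , combination , nonzero
      where
      combination : ∀ k → sum (λ i → λ′ i * homogenize i k) ≈ 0#
      combination zero    = trans (sum-cong-≋ (λ i → *-identityʳ (λ′ i))) (≡.subst (_≈ 0#) (Σ≡sum λ′) Σλ′≈0)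
      combination (suc k) = ≡.subst (_≈ 0#) (Σ≡sum (λ i → λ′ i * p i k)) (Σλ′p≈0 k)

    linear⇒affine : ∀ {U} → LinearlyDependent U homogenize → AffinelyDependent p U
    linear⇒affine (λ′ , supp , combination , nonzero) =
      λ′ , supp , ≡.subst (_≈ 0#) (≡.sym (Σ≡sum λ′)) (trans (sum-cong-≋ (λ i → sym (*-identityʳ (λ′ i)))) (combination zero)) ,
      (λ k → ≡.subst (_≈ 0#) (≡.sym (Σ≡sum (λ i → λ′ i * p i k))) (combination (suc k))) , nonzero

    affinelyDependent? : ∀ U → Dec (AffinelyDependent p U)
    affinelyDependent? U = map′ linear⇒affine affine⇒linear linearlyDependent?

    affinelyDependent-mono : ∀ {C U} → C ⊆ U → AffinelyDependent p C → AffinelyDependent p U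
    affinelyDependent-mono C⊆U (λ′ , supp , rest) = λ′ , (λ i i∉U → supp i (i∉U ∘ C⊆U)) , rest

    circuit-⊆ : ∀ {U} → AffinelyDependent p U → ∃ λ C → C ⊆ U × IsCircuit p C
    circuit-⊆ {U} = minimal-⊆ affinelyDependent? affinelyDependent-mono U

    affinelyDependent-if-too-many : ∀ {U} → suc d ℕ.< ∣ U ∣ → AffinelyDependent p U
    affinelyDependent-if-too-many too-many = linear⇒affine (dependent-if-too-many too-many)

    homogenize-difference : ∀ q j (φ : Vector Carrier (suc d)) →
                            (λ k → p q k - p j k) ∙ tail φ ≈ homogenize q ∙ φ - homogenize j ∙ φ
    homogenize-difference q j φ = begin
      (λ k → p q k - p j k) ∙ tail φ              ≈⟨ ∙-distrib-minusˡ (p q) (p j) (tail φ) ⟩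
      p q ∙ tail φ - p j ∙ tail φ                 ≈⟨ solve 3 (λ a x y → x :- y := (a :+ x) :- (a :+ y)) refl (1# * φ zero) (p q ∙ tail φ) (p j ∙ tail φ) ⟩
      homogenize q ∙ φ - homogenize j ∙ φ         ∎

    -- x is the linear part of an affine function φ with φ(p q) = 0 and φ(p j) = − b j,
    -- so that ⟨x, p q − p j⟩ = φ(p q) − φ(p j) = b j.
    extension : ∀ {U q} → AffinelyIndependent p U → q ∈ U → ∀ (v : Config n d) (g : Fin n → Carrier) →
                ∃ λ x → ∀ {j} → j ∈ U → j ≢ q → (λ k → x k - v j k) ∙ (λ k → p q k - p j k) ≈ g j
    extension {U} {q} independent q∈U v g = tail φ , x-ok
      where
      edge : Fin n → Vecᵈ d
      edge j k = p q k - p j k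
      b : Fin n → Carrier
      b j = g j + v j ∙ edge j
      value : Fin n → Carrier
      value j = b j * δ q j - b j
      φ : Vector Carrier (suc d)
      φ = proj₁ (independent⇒solvable (independent ∘ linear⇒affine) value)
      φ-ok : ∀ j → j ∈ U → homogenize j ∙ φ ≈ value j
      φ-ok = proj₂ (independent⇒solvable (independent ∘ linear⇒affine) value)
      x-ok : ∀ {j} → j ∈ U → j ≢ q → (λ k → tail φ k - v j k) ∙ edge j ≈ g j
      x-ok {j} j∈U j≢q = begin
        (λ k → tail φ k - v j k) ∙ edge j                ≈⟨ ∙-distrib-minusˡ (tail φ) (v j) (edge j) ⟩
        tail φ ∙ edge j - v j ∙ edge j                   ≈⟨ +-congʳ (∙-comm (tail φ) (edge j)) ⟩
        edge j ∙ tail φ - v j ∙ edge j                   ≈⟨ +-congʳ (homogenize-difference q j φ) ⟩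
        homogenize q ∙ φ - homogenize j ∙ φ - v j ∙ edge j ≈⟨ +-congʳ (+-cong (φ-ok q q∈U) (-‿cong (φ-ok j j∈U))) ⟩
        value q - value j - v j ∙ edge j                 ≈⟨ +-congʳ (+-cong (+-congʳ (*-congˡ (δ-diag q))) (-‿cong (+-congʳ (*-congˡ (δ-offdiag (j≢q ∘ ≡.sym)))))) ⟩
        (b q * 1# - b q) - (b j * 0# - b j) - v j ∙ edge j ≈⟨ solve 3 (λ bq gj w → (bq :* con (+ 1) :- bq) :- ((gj :+ w) :* con (+ 0) :- (gj :+ w)) :- w := gj) refl (b q) (g j) (v j ∙ edge j) ⟩
        g j                                              ∎

    Δ≡sum : ∀ w f C → Δ p w f C ≡ sum (λ i → sum (λ j → [ lookup C i ∧ lookup C j ∧ does (i Fin.<? j) ]? (w C i j * f i j)))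
    Δ≡sum w f C = ≡.trans (Σ≡sum (λ i → Σ[ n ] (term i))) (sum-cong-≗ (λ i → Σ≡sum (term i)))
      where
      term : Fin n → Fin n → Carrier
      term i j = [ lookup C i ∧ lookup C j ∧ does (i Fin.<? j) ]? (w C i j * f i j)

    Δ-minus : ∀ w f g C → Δ p w (λ x y → f x y - g x y) C ≈ Δ p w f C - Δ p w g C
    Δ-minus w f g C = begin
      Δ p w (λ x y → f x y - g x y) C                            ≡⟨ Δ≡sum w (λ x y → f x y - g x y) C ⟩
      sum (λ i → sum (λ j → [ b i j ]? (w C i j * (f i j - g i j))))  ≈⟨ sum-cong-≋ (λ i → sum-cong-≋ (λ j → pointwise i j)) ⟩
      sum (λ i → sum (λ j → F i j - G i j))                      ≈⟨ sum-cong-≋ (λ i → sum-minus (F i) (G i)) ⟩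
      sum (λ i → sum (F i) - sum (G i))                          ≈⟨ sum-minus (λ i → sum (F i)) (λ i → sum (G i)) ⟩
      sum (λ i → sum (F i)) - sum (λ i → sum (G i))              ≡⟨ ≡.cong₂ _-_ (Δ≡sum w f C) (Δ≡sum w g C) ⟨
      Δ p w f C - Δ p w g C                                      ∎
      where
      b : Fin n → Fin n → Bool
      b i j = lookup C i ∧ lookup C j ∧ does (i Fin.<? j)
      F G : Fin n → Fin n → Carrier
      F i j = [ b i j ]? (w C i j * f i j)
      G i j = [ b i j ]? (w C i j * g i j)
      pointwise : ∀ i j → [ b i j ]? (w C i j * (f i j - g i j)) ≈ F i j - G i j
      pointwise i j = trans ([]?-cong (b i j) (solve 3 (λ w f g → w :* (f :- g) := w :* f :- w :* g) refl (w C i j) (f i j) (g i j))) ([]?-minus (b i j) _ _)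

    equilibrium⇒Σ-moment≈0 : ∀ C (W : Fin n → Fin n → Carrier) (v : Config n d) → IsSelfStressOn p C W →
      sum (λ i → sum (λ j → [ lookup C i ∧ lookup C j ]? (W i j * (v i ∙ (λ k → p i k - p j k))))) ≈ 0#
    equilibrium⇒Σ-moment≈0 C W v (_ , equilibrium) = sum-zero row≈0
      where
      c : Fin n → Bool
      c = lookup C
      edge : Fin n → Fin n → Vecᵈ d
      edge i j k = p i k - p j k
      pull-out : ∀ i j → [ c j ]? (W i j * (v i ∙ edge i j)) ≈ sum (λ k → v i k * [ c j ]? (W i j * edge i j k))
      pull-out i j with c j
      ... | true  = trans (*-distribˡ-sum (W i j) (λ k → v i k * edge i j k)) (sum-cong-≋ (λ k → solve 3 (λ w x e → w :* (x :* e) := x :* (w :* e)) refl (W i j) (v i k) (edge i j k)))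
      ... | false = sym (sum-zero (λ k → zeroʳ (v i k)))
      row≈0 : ∀ i → sum (λ j → [ c i ∧ c j ]? (W i j * (v i ∙ edge i j))) ≈ 0#
      row≈0 i with c i in ci
      ... | false = sum-zero {f = λ j → [ false ∧ c j ]? (W i j * (v i ∙ edge i j))} (λ j → refl)
      ... | true  = begin
        sum (λ j → [ c j ]? (W i j * (v i ∙ edge i j)))                       ≈⟨ sum-cong-≋ (pull-out i) ⟩
        sum (λ j → sum (λ k → v i k * [ c j ]? (W i j * edge i j k)))         ≈⟨ ∑-comm (λ j k → v i k * [ c j ]? (W i j * edge i j k)) ⟩
        sum (λ k → sum (λ j → v i k * [ c j ]? (W i j * edge i j k)))         ≈⟨ sum-cong-≋ (λ k → *-distribˡ-sum (v i k) (λ j → [ c j ]? (W i j * edge i j k))) ⟨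
        sum (λ k → v i k * sum (λ j → [ c j ]? (W i j * edge i j k)))         ≈⟨ sum-zero (λ k → trans (*-congˡ (balanced k)) (zeroʳ (v i k))) ⟩
        0#                                                                    ∎
        where
        balanced : ∀ k → sum (λ j → [ c j ]? (W i j * edge i j k)) ≈ 0#
        balanced k = ≡.subst (_≈ 0#) (Σ≡sum (λ j → [ c j ]? (W i j * edge i j k))) (equilibrium i (lookup⇒[]= i C ci) k)

    stress⇒Δ-M≈0 : ∀ w C v → IsSelfStressOn p C (w C) → Δ p w (M p v) C ≈ 0#
    stress⇒Δ-M≈0 w C v stress@(W-sym , _) = begin
      Δ p w (M p v) C                                                   ≡⟨ Δ≡sum w (M p v) C ⟩
      sum (λ i → sum (λ j → [ c i ∧ c j ∧ lt i j ]? (W i j * M p v i j))) ≈⟨ sum-cong-≋ (λ i → sum-cong-≋ (λ j → []?-pair (c i) (c j) (lt i j) (split i j))) ⟩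
      sum (λ i → sum (λ j → [ lt i j ]? (G i j + G j i)))               ≈⟨ sum-over-pairs G G-diag≈0 ⟩
      sum (λ i → sum (λ j → G i j))                                     ≈⟨ equilibrium⇒Σ-moment≈0 C W v stress ⟩
      0#                                                                ∎
      where
      W : Fin n → Fin n → Carrier
      W = w C
      c : Fin n → Bool
      c = lookup C
      lt : Fin n → Fin n → Bool
      lt i j = does (i Fin.<? j)
      edge : Fin n → Fin n → Vecᵈ d
      edge i j k = p i k - p j k
      G : Fin n → Fin n → Carrier
      G i j = [ c i ∧ c j ]? (W i j * (v i ∙ edge i j))
      split : ∀ i j → T (c i) → T (c j) → W i j * M p v i j ≈ W i j * (v i ∙ edge i j) + W j i * (v j ∙ edge j i)
      split i j ci cj = begin
        W i j * M p v i j                                           ≡⟨ ≡.cong (W i j *_) (M≡∙ v i j) ⟩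
        W i j * ((λ k → v i k - v j k) ∙ edge i j)                  ≈⟨ *-congˡ (sum-cong-≋ (λ k → solve 4 (λ a b x y → (a :- b) :* (x :- y) := a :* (x :- y) :+ b :* (y :- x)) refl (v i k) (v j k) (p i k) (p j k))) ⟩
        W i j * sum (λ k → v i k * edge i j k + v j k * edge j i k) ≈⟨ *-congˡ (∑-distrib-+ (λ k → v i k * edge i j k) (λ k → v j k * edge j i k)) ⟩
        W i j * (v i ∙ edge i j + v j ∙ edge j i)                   ≈⟨ distribˡ (W i j) _ _ ⟩
        W i j * (v i ∙ edge i j) + W i j * (v j ∙ edge j i)         ≈⟨ +-congˡ (*-congʳ (W-sym i j (T-lookup⇒∈ ci) (T-lookup⇒∈ cj))) ⟩
        W i j * (v i ∙ edge i j) + W j i * (v j ∙ edge j i)         ∎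
      G-diag≈0 : ∀ i → G i i ≈ 0#
      G-diag≈0 i = []?-≈0 (c i ∧ c i) λ _ → trans (*-congˡ (sum-zero (λ k → trans (*-congˡ (-‿inverseʳ (p i k))) (zeroʳ (v i k))))) (zeroʳ (W i i))

    Δ-single-pair : ∀ w C (h : Fin n → Fin n → Carrier) {i j} → i ∈ C → j ∈ C → i Fin.< j →
                    (∀ {x y} → x ∈ C → y ∈ C → x Fin.< y → x ≢ i ⊎ y ≢ j → h x y ≈ 0#) →
                    Δ p w h C ≈ w C i j * h i j
    Δ-single-pair w C h {i} {j} i∈C j∈C i<j others≈0 = begin
      Δ p w h C                        ≡⟨ Δ≡sum w h C ⟩
      sum (λ x → sum (λ y → term x y)) ≈⟨ sum-single _ i (λ x x≢i → sum-zero (λ y → term≈0 {x} {y} (inj₁ x≢i))) ⟩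
      sum (λ y → term i y)             ≈⟨ sum-single _ j (λ y y≢j → term≈0 {i} {y} (inj₂ y≢j)) ⟩
      term i j                         ≈⟨ []?-true (b i j) (from T-∧ (∈⇒T-lookup i∈C , from T-∧ (∈⇒T-lookup j∈C , ℕ.<⇒<ᵇ i<j))) ⟩
      w C i j * h i j                  ∎
      where
      open Equivalence using (to; from)
      b : Fin n → Fin n → Bool
      b x y = lookup C x ∧ lookup C y ∧ does (x Fin.<? y)
      term : Fin n → Fin n → Carrier
      term x y = [ b x y ]? (w C x y * h x y)
      term≈0 : ∀ {x y} → x ≢ i ⊎ y ≢ j → term x y ≈ 0#
      term≈0 {x} {y} off = []?-≈0 (b x y) λ t →
        let x∈C , t′ = to T-∧ t ; y∈C , x<y = to T-∧ t′
        in  trans (*-congˡ (others≈0 (T-lookup⇒∈ x∈C) (T-lookup⇒∈ y∈C) (ℕ.<ᵇ⇒< (Fin.toℕ x) (Fin.toℕ y) x<y) off)) (zeroʳ _)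

    M-at : ∀ v {i j} (x y : Vecᵈ d) → v i ≡ x → v j ≡ y → M p v i j ≡ (λ k → x k - y k) ∙ (λ k → p i k - p j k)
    M-at v {i} {j} x y ≡.refl ≡.refl = M≡∙ v i j

    affinelyIndependent-⊆ : ∀ {C U} → C ⊆ U → AffinelyIndependent p U → AffinelyIndependent p C
    affinelyIndependent-⊆ C⊆U U-independent = U-independent ∘ affinelyDependent-mono C⊆U

    Realises : (Fin n → Fin n → Carrier) → Config n d → Subset n → Set
    Realises g v U = ∀ {i j} → i ∈ U → j ∈ U → i ≢ j → g i j ≈ M p v i j

    realisable : ∀ {g} → (∀ i j → g i j ≈ g j i) → ∀ U → AffinelyIndependent p U → ∃ λ v → Realises g v U
    realisable {g} g-sym = WF.All.wfRec ⊂-wellFounded 0ℓ (λ U → AffinelyIndependent p U → ∃ λ v → Realises g v U) step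
      where
      step : ∀ U → (∀ {V} → V ⊂ U → AffinelyIndependent p V → ∃ λ v → Realises g v V) →
             AffinelyIndependent p U → ∃ λ v → Realises g v U
      step U rec U-independent with nonempty? U
      ... | no  U-empty   = (λ _ _ → 0#) , λ i∈U _ _ → contradiction (_ , i∈U) U-empty
      ... | yes (t , t∈U) = v′ , v′-realises
        where
        realised-on-rest : ∃ λ v → Realises g v (U ∖ t)
        realised-on-rest = rec (x∈p⇒p-x⊂p t∈U) (affinelyIndependent-⊆ (p─q⊆p U ⁅ t ⁆) U-independent)
        v : Config n d
        v = proj₁ realised-on-rest
        v-realises : Realises g v (U ∖ t)
        v-realises = proj₂ realised-on-rest
        x : Vecᵈ d
        x = proj₁ (extension U-independent t∈U v (g t))
        x-ok : ∀ {j} → j ∈ U → j ≢ t → (λ k → x k - v j k) ∙ (λ k → p t k - p j k) ≈ g t j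
        x-ok = proj₂ (extension U-independent t∈U v (g t))
        v′ : Config n d
        v′ = updateAt v t (const x)
        unchanged : ∀ {j} → j ≢ t → v′ j ≡ v j
        unchanged {j} j≢t = updateAt-minimal j t v j≢t
        at-t : ∀ {j} → j ∈ U → j ≢ t → g t j ≈ M p v′ t j
        at-t {j} j∈U j≢t = trans (sym (x-ok j∈U j≢t)) (reflexive (≡.sym (M-at v′ x (v j) (updateAt-updates t v) (unchanged j≢t))))
        v′-realises : Realises g v′ U
        v′-realises {i} {j} i∈U j∈U i≢j with i Fin.≟ t | j Fin.≟ t
        ... | yes ≡.refl | _          = at-t j∈U (i≢j ∘ ≡.sym)
        ... | no  i≢t    | yes ≡.refl = trans (g-sym i t) (trans (at-t i∈U i≢t) (M-sym v′ t i))
        ... | no  i≢t    | no  j≢t    = begin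
          g i j                                              ≈⟨ v-realises (x∈p∧x≢y⇒x∈p-y i∈U i≢t) (x∈p∧x≢y⇒x∈p-y j∈U j≢t) i≢j ⟩
          M p v i j                                          ≡⟨ M≡∙ v i j ⟩
          (λ k → v i k - v j k) ∙ (λ k → p i k - p j k)      ≡⟨ M-at v′ (v i) (v j) (unchanged i≢t) (unchanged j≢t) ⟨
          M p v′ i j                                         ∎

    module _ {S : Subset n} (S-independent : AffinelyIndependent p S)
             (S-alone : ∀ k → k ∉ S → ¬ InAffineSpan p S (p k)) where

      independent-∪-outside : ∀ {q} → q ∉ S → AffinelyIndependent p (S ∪ ⁅ q ⁆)
      independent-∪-outside {q} q∉S dependent@(λ′ , supp , _) with λ′ q ≟ 0#
      ... | yes λ′q≈0 = S-independent (λ′ , supp-S , proj₂ (proj₂ dependent))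
        where
        supp-S : ∀ j → j ∉ S → λ′ j ≈ 0#
        supp-S j j∉S with j Fin.≟ q
        ... | yes ≡.refl = λ′q≈0
        ... | no  j≢q    = supp j (Sum.[ j∉S , j≢q ] ∘ x∈p∪⁅y⁆⁻)
      ... | no  λ′q≉0 = S-alone q q∉S (μ , supp-μ , affine-sum , affine-point)
        where
        expressed : ∃ λ μ → μ q ≈ 0# × (∀ j → λ′ j ≈ 0# → μ j ≈ 0#) × ∀ k → sum (λ j → μ j * homogenize j k) ≈ homogenize q k
        expressed = dependence⇒combination homogenize λ′ q (proj₁ (proj₂ (proj₂ (affine⇒linear dependent)))) λ′q≉0
        μ : Vector Carrier n
        μ = proj₁ expressed
        μq≈0 : μ q ≈ 0#
        μq≈0 = proj₁ (proj₂ expressed)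
        μ-supported : ∀ j → λ′ j ≈ 0# → μ j ≈ 0#
        μ-supported = proj₁ (proj₂ (proj₂ expressed))
        μ-combination : ∀ k → sum (λ j → μ j * homogenize j k) ≈ homogenize q k
        μ-combination = proj₂ (proj₂ (proj₂ expressed))
        supp-μ : ∀ j → j ∉ S → μ j ≈ 0#
        supp-μ j j∉S with j Fin.≟ q
        ... | yes ≡.refl = μq≈0
        ... | no  j≢q    = μ-supported j (supp j (Sum.[ j∉S , j≢q ] ∘ x∈p∪⁅y⁆⁻))
        affine-sum : Σ[ n ] μ ≈ 1#
        affine-sum = ≡.subst (_≈ 1#) (≡.sym (Σ≡sum μ)) (trans (sum-cong-≋ (λ j → sym (*-identityʳ (μ j)))) (μ-combination zero))
        affine-point : ∀ k → Σ[ n ] (λ j → μ j * p j k) ≈ p q k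
        affine-point k = ≡.subst (_≈ p q k) (≡.sym (Σ≡sum (λ j → μ j * p j k))) (μ-combination (suc k))

      circuit-meets : ∀ {i j C} → i ∉ S → IsCircuit p C → C ⊆ (S ∪ ⁅ i ⁆) ∪ ⁅ j ⁆ → j ∈ C
      circuit-meets {i} {j} {C} i∉S C-circuit C⊆ = decidable-stable (j ∈? C) λ j∉C →
        independent-∪-outside i∉S (affinelyDependent-mono (q⊆p∪⁅y⁆∧y∉q⇒q⊆p C⊆ j∉C) (proj₁ C-circuit))

      more-than-d+1 : ∀ {i j} → ∣ S ∣ ≡ d → i ∉ S → j ∉ S → i ≢ j → suc d ℕ.< ∣ (S ∪ ⁅ i ⁆) ∪ ⁅ j ⁆ ∣
      more-than-d+1 {i} {j} ∣S∣≡d i∉S j∉S i≢j = ℕ.<-≤-trans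
        (ℕ.s≤s (≡.subst (ℕ._< ∣ S ∪ ⁅ i ⁆ ∣) ∣S∣≡d (p⊂q⇒∣p∣<∣q∣ (y∉p⇒p⊂p∪⁅y⁆ i∉S))))
        (p⊂q⇒∣p∣<∣q∣ (y∉p⇒p⊂p∪⁅y⁆ (Sum.[ j∉S , i≢j ∘ ≡.sym ] ∘ x∈p∪⁅y⁆⁻)))

      circuit-through : ∀ {i j} → ∣ S ∣ ≡ d → i ∉ S → j ∉ S → i ≢ j →
                        ∃ λ C → IsCircuit p C × C ⊆ (S ∪ ⁅ i ⁆) ∪ ⁅ j ⁆ × i ∈ C × j ∈ C
      circuit-through ∣S∣≡d i∉S j∉S i≢j =
        let C , C⊆ , C-circuit = circuit-⊆ (affinelyDependent-if-too-many (more-than-d+1 ∣S∣≡d i∉S j∉S i≢j))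
        in  C , C-circuit , C⊆ , circuit-meets j∉S C-circuit (⊆-trans C⊆ p∪⁅y⁆∪⁅z⁆⊆p∪⁅z⁆∪⁅y⁆) , circuit-meets i∉S C-circuit C⊆

      module _ (f : Fin n → Fin n → Carrier) where

        symmetrise-comm≈ : ∀ i j → symmetrise f i j ≈ symmetrise f j i
        symmetrise-comm≈ i j = reflexive (symmetrise-comm f i j)

        v₁ : Config n d
        v₁ = proj₁ (realisable symmetrise-comm≈ S S-independent)

        v₁-realises : Realises (symmetrise f) v₁ S
        v₁-realises = proj₂ (realisable symmetrise-comm≈ S S-independent)

        extension-outside : ∀ {q} → q ∉ S → ∃ λ x → ∀ {j} → j ∈ S → (λ k → x k - v₁ j k) ∙ (λ k → p q k - p j k) ≈ symmetrise f q j
        extension-outside {q} q∉S = proj₁ extended , λ j∈S → proj₂ extended (x∈p∪q⁺ (inj₁ j∈S)) λ { ≡.refl → q∉S j∈S }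
          where
          extended : ∃ λ x → ∀ {j} → j ∈ S ∪ ⁅ q ⁆ → j ≢ q → (λ k → x k - v₁ j k) ∙ (λ k → p q k - p j k) ≈ symmetrise f q j
          extended = extension (independent-∪-outside q∉S) y∈p∪⁅y⁆ v₁ (symmetrise f q)

        -- Lemmas about realisation case on the membership proof passed to pick; a with on
        -- q ∈? S would not reach the occurrence hidden inside M.
        pick : ∀ q → Dec (q ∈ S) → Vecᵈ d
        pick q (yes _)   = v₁ q
        pick q (no  q∉S) = proj₁ (extension-outside q∉S)

        realisation : Config n d
        realisation q = pick q (q ∈? S)

        realisation-on-S : ∀ {q} → q ∈ S → realisation q ≡ v₁ q
        realisation-on-S {q} q∈S with q ∈? S
        ... | yes _   = ≡.refl
        ... | no  q∉S = contradiction q∈S q∉S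

        pick-outside : ∀ {q j} (q∈?S : Dec (q ∈ S)) → q ∉ S → j ∈ S →
                       (λ k → pick q q∈?S k - v₁ j k) ∙ (λ k → p q k - p j k) ≈ symmetrise f q j
        pick-outside (yes q∈S) q∉S j∈S = contradiction q∈S q∉S
        pick-outside (no  q∉S) _   j∈S = proj₂ (extension-outside q∉S) j∈S

        realisation-outside : ∀ {q j} → q ∉ S → j ∈ S → symmetrise f q j ≈ M p realisation q j
        realisation-outside {q} {j} q∉S j∈S =
          trans (sym (pick-outside (q ∈? S) q∉S j∈S)) (reflexive (≡.sym (M-at realisation (realisation q) (v₁ j) ≡.refl (realisation-on-S j∈S))))

        realisation-touching-S : ∀ {i j} → i ≢ j → i ∈ S ⊎ j ∈ S → symmetrise f i j ≈ M p realisation i j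
        realisation-touching-S {i} {j} i≢j touching = by-membership (i ∈? S) (j ∈? S)
          where
          by-membership : Dec (i ∈ S) → Dec (j ∈ S) → symmetrise f i j ≈ M p realisation i j
          by-membership (yes i∈S) (yes j∈S) = begin
            symmetrise f i j                                  ≈⟨ v₁-realises i∈S j∈S i≢j ⟩
            M p v₁ i j                                        ≡⟨ M≡∙ v₁ i j ⟩
            (λ k → v₁ i k - v₁ j k) ∙ (λ k → p i k - p j k)  ≡⟨ M-at realisation (v₁ i) (v₁ j) (realisation-on-S i∈S) (realisation-on-S j∈S) ⟨
            M p realisation i j                               ∎
          by-membership (no  i∉S) (yes j∈S) = realisation-outside i∉S j∈S
          by-membership (yes i∈S) (no  j∉S) = trans (symmetrise-comm≈ i j) (trans (realisation-outside j∉S i∈S) (M-sym realisation j i))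
          by-membership (no  i∉S) (no  j∉S) = contradiction touching Sum.[ i∉S , j∉S ]

        agrees-touching-S : ∀ {x y} → x Fin.< y → x ∈ S ⊎ y ∈ S → f x y ≈ M p realisation x y
        agrees-touching-S x<y touching = trans (reflexive (≡.sym (symmetrise-< f x<y))) (realisation-touching-S (Finₚ.<⇒≢ x<y) touching)

        module _ (∣S∣≡d : ∣ S ∣ ≡ d) (w : Subset n → Fin n → Fin n → Carrier)
                 (w-stress : ∀ C → IsCircuit p C → IsSelfStressOn p C (w C) × AllEntriesNonzeroOn p C (w C))
                 (f∈kerΔ : ∀ C → IsCircuit p C → Δ p w f C ≈ 0#) where

          agrees-outside-S : ∀ {i j} → i ∉ S → j ∉ S → i Fin.< j → f i j ≈ M p realisation i j
          agrees-outside-S {i} {j} i∉S j∉S i<j with circuit-through ∣S∣≡d i∉S j∉S (Finₚ.<⇒≢ i<j)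
          ... | C , C-circuit , C⊆ , i∈C , j∈C = x∙y⁻¹≈ε⇒x≈y (f i j) (M p realisation i j) hij≈0
            where
            h : Fin n → Fin n → Carrier
            h x y = f x y - M p realisation x y
            Δh≈0 : Δ p w h C ≈ 0#
            Δh≈0 = begin
              Δ p w h C                                   ≈⟨ Δ-minus w f (M p realisation) C ⟩
              Δ p w f C - Δ p w (M p realisation) C       ≈⟨ +-cong (f∈kerΔ C C-circuit) (-‿cong (stress⇒Δ-M≈0 w C realisation (proj₁ (w-stress C C-circuit)))) ⟩
              0# - 0#                                     ≈⟨ -‿inverseʳ 0# ⟩
              0#                                          ∎
            others≈0 : ∀ {x y} → x ∈ C → y ∈ C → x Fin.< y → x ≢ i ⊎ y ≢ j → h x y ≈ 0#
            others≈0 x∈C y∈C x<y other = x≈y⇒x∙y⁻¹≈ε (agrees-touching-S x<y (other-pair-meets i<j (C⊆ x∈C) (C⊆ y∈C) x<y other))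
            hij≈0 : h i j ≈ 0#
            hij≈0 = x≉0∧x*y≈0⇒y≈0 (proj₂ (w-stress C C-circuit) i j i∈C j∈C (Finₚ.<⇒≢ i<j))
                                    (trans (sym (Δ-single-pair w C h i∈C j∈C i<j others≈0)) Δh≈0)

          agrees : ∀ i j → i Fin.< j → f i j ≈ M p realisation i j
          agrees i j i<j = by-membership (i ∈? S) (j ∈? S)
            where
            by-membership : Dec (i ∈ S) → Dec (j ∈ S) → f i j ≈ M p realisation i j
            by-membership (yes i∈S) _         = agrees-touching-S i<j (inj₁ i∈S)
            by-membership (no  _)   (yes j∈S) = agrees-touching-S i<j (inj₂ j∈S)
            by-membership (no  i∉S) (no  j∉S) = agrees-outside-S i∉S j∉S i<j

proposition6p1 : (ℝ : Reals) → let open Geometry ℝ in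
    (n d : ℕ) (p : Config n d) → Distinct p →
    (w : Subset n → Fin n → Fin n → Carrier) →
    (∀ C → IsCircuit p C → IsSelfStressOn p C (w C) × AllEntriesNonzeroOn p C (w C)) →
    -- Im M ⊆ ker Δ
    (∀ (v : Config n d) C → IsCircuit p C → Δ p w (M p v) C ≈ 0#)
    ×
    -- under the extra hypothesis, ker Δ ⊆ Im M (hence Im M = ker Δ)
    ((∃ λ (S : Subset n) → ∣ S ∣ ≡ d × AffinelyIndependent p S ×
        (∀ k → k ∉ S → ¬ InAffineSpan p S (p k))) →
     ∀ (f : Fin n → Fin n → Carrier) →
     (∀ C → IsCircuit p C → Δ p w f C ≈ 0#) →
     ∃ λ (v : Config n d) → ∀ i j → i <ᶠ j → f i j ≈ M p v i j)
proposition6p1 ℝ n d p _ w w-stress = image⊆kernel , kernel⊆image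
  where
  open Geometry ℝ
  open Configurations ℝ
  image⊆kernel : ∀ v C → IsCircuit p C → Δ p w (M p v) C ≈ 0#
  image⊆kernel v C C-circuit = stress⇒Δ-M≈0 p w C v (proj₁ (w-stress C C-circuit))
  kernel⊆image : (∃ λ S → ∣ S ∣ ≡ d × AffinelyIndependent p S × (∀ k → k ∉ S → ¬ InAffineSpan p S (p k))) →
                 ∀ f → (∀ C → IsCircuit p C → Δ p w f C ≈ 0#) → ∃ λ v → ∀ i j → i <ᶠ j → f i j ≈ M p v i j
  kernel⊆image (S , ∣S∣≡d , S-independent , S-alone) f f∈kerΔ =
    realisation p S-independent S-alone f , agrees p S-independent S-alone f ∣S∣≡d w w-stress f∈kerΔ
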